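{- Let $a<b$ be positive integers. If $G$ is an $(a,b)$-biregular graph, then $\check s(G)\geq 1+\lceil b/a\rceil$.
   Context: A graph is $(a,b)$-biregular if it is bipartite with a bipartition $(X,Y)$, $X,Y$ nonempty, such that every vertex of $X$ has degree $a$ and every vertex of $Y$ has degree $b$. For a proper edge coloring $\varphi$ of a graph $G$, the palette of a vertex $v$ is the set of colors on edges incident with $v$. The palette index $\check s(G)$ is the minimum number of distinct palettes over all proper edge colorings of $G$. -}

module Defs where

open import Data.Nat using (ℕ; zero; suc; _+_; _/_; _≡ᵇ_)
open import Data.Bool using (Bool; true; false; _∧_; T)
open import Data.Fin using (Fin)
open import Data.List using (List; map; filterᵇ; length; deduplicateᵇ; allFin)
open import Data.Bool.ListAction using (any; all)
open import Data.Product using (Σ; _×_; ∃)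
open import Relation.Binary.PropositionalEquality using (_≡_; _≢_)

record Graph (n : ℕ) : Set where
  field
    adj     : Fin n → Fin n → Bool
    adj-sym : ∀ u v → adj u v ≡ adj v u
    adj-irr : ∀ v → adj v v ≡ false
open Graph public

nbrs : ∀ {n} → Graph n → Fin n → List (Fin n)
nbrs G v = filterᵇ (adj G v) (allFin _)

deg : ∀ {n} → Graph n → Fin n → ℕ
deg G v = length (nbrs G v)

-- (a,b)-biregular: bipartite with bipartition (X,Y) (X = vertices with side
-- true), X and Y nonempty, deg a on X, deg b on Y.
Biregular : ∀ {n} → ℕ → ℕ → Graph n → Set
Biregular {n} a b G =
  Σ (Fin n → Bool) λ side →
    (∀ u v → adj G u v ≡ true → side u ≢ side v)
  × (∃ λ x → side x ≡ true)
  × (∃ λ y → side y ≡ false)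
  × (∀ v → side v ≡ true → deg G v ≡ a)
  × (∀ v → side v ≡ false → deg G v ≡ b)

-- An edge colouring with colours in ℕ: c u v is the colour of the edge uv
-- (values on non-edges are irrelevant).
EdgeColouring : ℕ → Set
EdgeColouring n = Fin n → Fin n → ℕ

-- proper: well defined on edges (symmetric) and adjacent edges get different colours
Proper : ∀ {n} → Graph n → EdgeColouring n → Set
Proper {n} G c =
    (∀ u v → adj G u v ≡ true → c u v ≡ c v u)
  × (∀ v u w → adj G v u ≡ true → adj G v w ≡ true → c v u ≡ c v w → u ≡ w)

-- palette of v: colours of the edges incident with v (as a list, read as a set)
palette : ∀ {n} → Graph n → EdgeColouring n → Fin n → List ℕ
palette G c v = map (c v) (nbrs G v)

memberᵇ : ℕ → List ℕ → Bool
memberᵇ k xs = any (k ≡ᵇ_) xs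

subsetᵇ : List ℕ → List ℕ → Bool
subsetᵇ xs ys = all (λ k → memberᵇ k ys) xs

samePaletteᵇ : ∀ {n} → Graph n → EdgeColouring n → Fin n → Fin n → Bool
samePaletteᵇ G c v w = subsetᵇ (palette G c v) (palette G c w) ∧ subsetᵇ (palette G c w) (palette G c v)

numPalettes : ∀ {n} → Graph n → EdgeColouring n → ℕ
numPalettes {n} G c = length (deduplicateᵇ (samePaletteᵇ G c) (allFin n))

ceilDiv : ℕ → ℕ → ℕ
ceilDiv b zero    = 0
ceilDiv b (suc a) = (b + a) / suc a

PaletteIndex≥ : ∀ {n} → Graph n → ℕ → Set
PaletteIndex≥ {n} G k = ∀ (c : EdgeColouring n) → Proper G c → k Data.Nat.≤ numPalettes G c

module Submission where

-- Fix a proper edge colouring c, with sides X (degree a) and Y (degree b).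
--  * A palette repeats no colour, so its size is the degree of its vertex.
--    Vertices with the same palette thus have the same degree, and as a ≠ b
--    no palette occurs on both sides.
--  * Take y ∈ Y. Each of its b colours is the colour of an edge yx with x ∈ X,
--    so it lies in the palette of x. Hence the b colours of y are covered by
--    the m distinct X-palettes, each of size a: b ≤ m·a, i.e. m ≥ ⌈b/a⌉.
--  * The palette of y is not an X-palette, so there are at least 1 + ⌈b/a⌉.

open import Defs
open import Data.Nat using (ℕ; suc; _+_; _*_; _≤_; _<_; _≡ᵇ_; s≤s; s≤s⁻¹; z≤n)
open import Data.Nat.Properties using (≡ᵇ⇒≡; ≡⇒≡ᵇ; ≤-antisym; ≤-trans; ≤-reflexive; <⇒≢; +-mono-≤; +-monoˡ-≤; +-comm)
open import Data.Nat.DivMod using (m<n*o⇒m/o<n)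
open import Data.Bool using (Bool; true; false; T; not)
open import Data.Bool.Properties using (T?; T-∧; T-≡; ¬-not)
open import Data.Fin using (Fin)
open import Data.List using (List; []; _∷_; map; concatMap; filterᵇ; length; deduplicateᵇ; allFin)
open import Data.List.Properties using (length-map; length-++; filter-notAll)
open import Data.List.Membership.Propositional using (_∈_; find; lose)
open import Data.List.Membership.Propositional.Properties
  using (∈-filter⁺; ∈-filter⁻; ∈-map⁺; ∈-map⁻; ∈-allFin; ∈-concat⁺′)
open import Data.List.Relation.Binary.Subset.Propositional using (_⊆_)
open import Data.List.Relation.Unary.Any using (Any; here; there)
import Data.List.Relation.Unary.Any as Any
import Data.List.Relation.Unary.Any.Properties as AnyP
import Data.List.Relation.Unary.All as All
import Data.List.Relation.Unary.All.Properties as AllP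
open import Data.List.Relation.Unary.AllPairs using ([]; _∷_)
open import Data.List.Relation.Unary.Unique.Propositional using (Unique)
open import Data.List.Relation.Unary.Unique.Propositional.Properties using (allFin⁺; filter⁺)
open import Data.Product using (_×_; ∃; _,_; proj₁; proj₂)
open import Data.Empty using (⊥-elim)
open import Relation.Nullary using (¬_)
open import Function using (_∘_; _∘₂_; Equivalence)
open import Relation.Binary.PropositionalEquality using (_≡_; _≢_; refl; sym; trans; cong; subst; subst₂; ≢-sym)

memberᵇ⇒∈ : ∀ {k} xs → T (memberᵇ k xs) → k ∈ xs
memberᵇ⇒∈ {k} xs t = Any.map (λ {x} → ≡ᵇ⇒≡ k x) (AnyP.any⁻ (k ≡ᵇ_) xs t)

∈⇒memberᵇ : ∀ {k xs} → k ∈ xs → T (memberᵇ k xs)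
∈⇒memberᵇ {k} k∈xs = AnyP.any⁺ (k ≡ᵇ_) (Any.map (λ {x} → ≡⇒≡ᵇ k x) k∈xs)

subsetᵇ⇒⊆ : ∀ xs ys → T (subsetᵇ xs ys) → xs ⊆ ys
subsetᵇ⇒⊆ xs ys t k∈xs = memberᵇ⇒∈ ys (All.lookup (AllP.all⁺ (λ k → memberᵇ k ys) xs t) k∈xs)

⊆⇒subsetᵇ : ∀ xs ys → xs ⊆ ys → T (subsetᵇ xs ys)
⊆⇒subsetᵇ xs ys xs⊆ys = AllP.all⁻ (λ k → memberᵇ k ys) (All.tabulate (∈⇒memberᵇ ∘ xs⊆ys))

module Counting {A : Set} where

  remove : ∀ {x : A} ys → x ∈ ys → List A
  remove (y ∷ ys) (here _)  = ys
  remove (y ∷ ys) (there p) = y ∷ remove ys p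

  length-remove : ∀ {x : A} ys (p : x ∈ ys) → suc (length (remove ys p)) ≡ length ys
  length-remove (y ∷ ys) (here _)  = refl
  length-remove (y ∷ ys) (there p) = cong suc (length-remove ys p)

  ∈-remove : ∀ {x z : A} ys (p : x ∈ ys) → z ∈ ys → z ≢ x → z ∈ remove ys p
  ∈-remove (y ∷ ys) (here refl) (here refl) z≢x = ⊥-elim (z≢x refl)
  ∈-remove (y ∷ ys) (here refl) (there q)   z≢x = q
  ∈-remove (y ∷ ys) (there p)   (here refl) z≢x = here refl
  ∈-remove (y ∷ ys) (there p)   (there q)   z≢x = there (∈-remove ys p q z≢x)

  -- Pigeonhole for lists: a duplicate-free list included in ys is no longer
  -- than ys. Each element of xs is matched to an occurrence in ys, deleted.
  unique-⊆⇒length≤ : ∀ {xs ys : List A} → Unique xs → xs ⊆ ys → length xs ≤ length ys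
  unique-⊆⇒length≤ {[]}     []              _      = z≤n
  unique-⊆⇒length≤ {x ∷ xs} {ys} (x∉xs ∷ xs!) xs⊆ys =
    subst (suc (length xs) ≤_) (length-remove ys x∈ys)
      (s≤s (unique-⊆⇒length≤ xs! (λ z∈xs →
        ∈-remove ys x∈ys (xs⊆ys (there z∈xs)) (≢-sym (All.lookup x∉xs z∈xs)))))
    where
    x∈ys : x ∈ ys
    x∈ys = xs⊆ys (here refl)

  map-unique : ∀ {B : Set} (f : A → B) {xs : List A} → Unique xs →
    (∀ {u w} → u ∈ xs → w ∈ xs → f u ≡ f w → u ≡ w) → Unique (map f xs)
  map-unique f {[]}     []           inj = []
  map-unique f {x ∷ xs} (x∉xs ∷ xs!) inj =
    AllP.map⁺ (All.tabulate (λ w∈xs fx≡fw → All.lookup x∉xs w∈xs (inj (here refl) (there w∈xs) fx≡fw)))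
    ∷ map-unique f xs! (λ u∈ w∈ → inj (there u∈) (there w∈))

  length-concatMap≤ : ∀ {B : Set} (f : A → List B) (a : ℕ) xs →
    (∀ {x} → x ∈ xs → length (f x) ≤ a) → length (concatMap f xs) ≤ length xs * a
  length-concatMap≤ f a []       short = z≤n
  length-concatMap≤ f a (x ∷ xs) short =
    subst (_≤ a + length xs * a) (sym (length-++ (f x)))
      (+-mono-≤ (short (here refl)) (length-concatMap≤ f a xs (short ∘ there)))

open Counting

ceilDiv-least : ∀ a b m → 0 < a → b ≤ m * a → ceilDiv b a ≤ m
ceilDiv-least (suc a′) b m _ b≤ma = s≤s⁻¹ (m<n*o⇒m/o<n {n = suc m} b+a′<[1+m]a)
  where
  b+a′<[1+m]a : b + a′ < suc m * suc a′
  b+a′<[1+m]a = s≤s (subst (b + a′ ≤_) (+-comm (m * suc a′) a′) (+-monoˡ-≤ a′ b≤ma))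

module Palettes {n} (G : Graph n) (c : EdgeColouring n) (proper : Proper G c) where

  pal : Fin n → List ℕ
  pal = palette G c

  SamePalette : Fin n → Fin n → Set
  SamePalette v w = T (samePaletteᵇ G c v w)

  samePalette⇒⊆⊇ : ∀ {v w} → SamePalette v w → pal v ⊆ pal w × pal w ⊆ pal v
  samePalette⇒⊆⊇ {v} {w} s =
    let vw , wv = Equivalence.to T-∧ s
    in subsetᵇ⇒⊆ (pal v) (pal w) vw , subsetᵇ⇒⊆ (pal w) (pal v) wv

  ⊆⊇⇒samePalette : ∀ {v w} → pal v ⊆ pal w → pal w ⊆ pal v → SamePalette v w
  ⊆⊇⇒samePalette {v} {w} vw wv =
    Equivalence.from T-∧ (⊆⇒subsetᵇ (pal v) (pal w) vw , ⊆⇒subsetᵇ (pal w) (pal v) wv)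

  samePalette-refl : ∀ v → SamePalette v v
  samePalette-refl v = ⊆⊇⇒samePalette (λ k∈ → k∈) (λ k∈ → k∈)

  samePalette-trans : ∀ {u v w} → SamePalette u v → SamePalette v w → SamePalette u w
  samePalette-trans uv vw =
    let uv⊆ , vu⊆ = samePalette⇒⊆⊇ uv
        vw⊆ , wv⊆ = samePalette⇒⊆⊇ vw
    in ⊆⊇⇒samePalette (vw⊆ ∘ uv⊆) (vu⊆ ∘ wv⊆)

  nbr⇒adj : ∀ {v u} → u ∈ nbrs G v → adj G v u ≡ true
  nbr⇒adj {v} u∈ = Equivalence.to T-≡ (proj₂ (∈-filter⁻ (T? ∘ adj G v) {xs = allFin n} u∈))

  adj⇒nbr : ∀ {v u} → adj G v u ≡ true → u ∈ nbrs G v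
  adj⇒nbr {v} vu = ∈-filter⁺ (T? ∘ adj G v) (∈-allFin _) (Equivalence.from T-≡ vu)

  -- Properness: the colours at a vertex are pairwise distinct, so the palette
  -- is duplicate-free and its size is the degree.
  palette-unique : ∀ v → Unique (pal v)
  palette-unique v = map-unique (c v) (filter⁺ (T? ∘ adj G v) (allFin⁺ n))
    (λ u∈ w∈ → proj₂ proper v _ _ (nbr⇒adj u∈) (nbr⇒adj w∈))

  length-palette : ∀ v → length (pal v) ≡ deg G v
  length-palette v = length-map (c v) (nbrs G v)

  samePalette⇒deg≡ : ∀ {v w} → SamePalette v w → deg G v ≡ deg G w
  samePalette⇒deg≡ {v} {w} s =
    let v⊆w , w⊆v = samePalette⇒⊆⊇ s
    in subst₂ _≡_ (length-palette v) (length-palette w)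
         (≤-antisym (unique-⊆⇒length≤ (palette-unique v) v⊆w)
                    (unique-⊆⇒length≤ (palette-unique w) w⊆v))

  edgeColour∈palette : ∀ {v u} → adj G v u ≡ true → c v u ∈ pal u
  edgeColour∈palette {v} {u} vu =
    subst (_∈ pal u) (sym (proj₁ proper v u vu))
      (∈-map⁺ (c u) (adj⇒nbr (trans (adj-sym G u v) vu)))

  representatives : List (Fin n)
  representatives = deduplicateᵇ (samePaletteᵇ G c) (allFin n)

  representative : ∀ z → ∃ λ d → d ∈ representatives × SamePalette d z
  representative z =
    find (AnyP.deduplicate⁺ (T? ∘₂ samePaletteᵇ G c) samePalette-trans
           (lose (∈-allFin z) (samePalette-refl z)))

  -- A bipartite graph whose side X has degree a and side Y degree b ≠ a.
  module TwoDegrees (side : Fin n → Bool)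
                    (bipartite : ∀ u v → adj G u v ≡ true → side u ≢ side v)
                    {a b : ℕ} (a≢b : a ≢ b)
                    (degX : ∀ v → side v ≡ true → deg G v ≡ a)
                    (degY : ∀ v → side v ≡ false → deg G v ≡ b) where

    -- Palettes on the two sides have different sizes, so no class crosses sides.
    samePalette⇒sameSide : ∀ {v w} → SamePalette v w → side v ≡ side w
    samePalette⇒sameSide {v} {w} s with side v in sv | side w in sw
    ... | true  | true  = refl
    ... | false | false = refl
    ... | true  | false = ⊥-elim (a≢b (trans (sym (degX v sv)) (trans (samePalette⇒deg≡ s) (degY w sw))))
    ... | false | true  = ⊥-elim (a≢b (trans (sym (degX w sw)) (trans (sym (samePalette⇒deg≡ s)) (degY v sv))))

    xRepresentatives : List (Fin n)
    xRepresentatives = filterᵇ side representatives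

    -- A vertex of Y carries a palette that is not an X-palette.
    xPalettes<palettes : ∀ y → side y ≡ false → length xRepresentatives < length representatives
    xPalettes<palettes y sy =
      let d , d∈ , d≈y = representative y
          d∉X : ¬ T (side d)
          d∉X = subst T (trans (samePalette⇒sameSide d≈y) sy)
      in filter-notAll (T? ∘ side) representatives (Any.map (λ { refl → d∉X }) d∈)

    -- Every colour at y ∈ Y is the colour of an edge to some x ∈ X, hence lies
    -- in the palette of x and so in the X-palette representing it.
    yPalette⊆xPalettes : ∀ y → side y ≡ false → pal y ⊆ concatMap pal xRepresentatives
    yPalette⊆xPalettes y sy k∈ with ∈-map⁻ (c y) k∈
    ... | x , x∈ , refl =
      let d , d∈ , d≈x = representative x
          yx = nbr⇒adj x∈
          sx = trans (¬-not (≢-sym (bipartite y x yx))) (cong not sy)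
          d∈X = ∈-filter⁺ (T? ∘ side) d∈ (Equivalence.from T-≡ (trans (samePalette⇒sameSide d≈x) sx))
      in ∈-concat⁺′ (proj₂ (samePalette⇒⊆⊇ d≈x) (edgeColour∈palette yx)) (∈-map⁺ pal d∈X)

    degY≤xPalettes*a : ∀ y → side y ≡ false → b ≤ length xRepresentatives * a
    degY≤xPalettes*a y sy =
      subst (_≤ length xRepresentatives * a) (trans (length-palette y) (degY y sy))
        (≤-trans (unique-⊆⇒length≤ (palette-unique y) (yPalette⊆xPalettes y sy))
                 (length-concatMap≤ pal a xRepresentatives xPaletteSize))
      where
      xPaletteSize : ∀ {d} → d ∈ xRepresentatives → length (pal d) ≤ a
      xPaletteSize {d} d∈ =
        let sd = Equivalence.to T-≡ (proj₂ (∈-filter⁻ (T? ∘ side) {xs = representatives} d∈))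
        in ≤-reflexive (trans (length-palette d) (degX d sd))

lemma4p1 : (a b : ℕ) → 0 < a → a < b →
    ∀ {n} (G : Graph n) → Biregular a b G →
    PaletteIndex≥ G (suc (ceilDiv b a))
lemma4p1 a b 0<a a<b G (side , bipartite , _ , (y , sy) , degX , degY) c proper =
  ≤-trans (s≤s ⌈b/a⌉≤m) (xPalettes<palettes y sy)
  where
  open Palettes G c proper
  open TwoDegrees side bipartite (<⇒≢ a<b) degX degY
  ⌈b/a⌉≤m : ceilDiv b a ≤ length xRepresentatives
  ⌈b/a⌉≤m = ceilDiv-least a b _ 0<a (degY≤xPalettes*a y sy)
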